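{- Let $\mathbf{c}=(c_1,\dots,c_n)\in\mathbb{Z}_{>0}^n$ and let $a<b$ be nonnegative integers. Then \[ \operatorname{ehr}(\mathscr{R}'_{a,b,\mathbf{c}},t)=\operatorname{ehr}(\mathscr{R}_{b,\mathbf{c}'},t), \] where $\mathbf{c}'=(c_1,\dots,c_n,b-a)\in\mathbb{Z}_{>0}^{n+1}$.
   Context: For $\mathbf{d}=(d_1,\dots,d_N)\in\mathbb{Z}_{>0}^N$ and $k\in\mathbb{Z}_{>0}$, $\mathscr{R}_{k,\mathbf{d}}=\{x\in\mathbb{R}^N : 0\le x_i\le d_i \text{ for all } i,\ \sum_i x_i=k\}$. For $\mathbf{c}\in\mathbb{Z}_{>0}^n$, $\mathscr{R}'_{a,b,\mathbf{c}}=\{x\in\mathbb{R}^n : 0\le x_i\le c_i \text{ for all } i,\ a\le\sum_i x_i\le b\}$. $\operatorname{ehr}(\mathscr{P},t)$ denotes the Ehrhart polynomial, i.e. the polynomial with $\operatorname{ehr}(\mathscr{P},t)=\#(t\mathscr{P}\cap\mathbb{Z}^N)$ for all positive integers $t$ ($\mathscr{P}\subseteq\mathbb{R}^N$). -}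

module Defs where

open import Data.Nat using (ℕ; zero; suc; _+_; _*_; _≤_; _≤?_)
open import Data.Nat.Properties using (_≟_)
open import Data.List using (List; []; _∷_; [_]; upTo; concatMap; length; filter)
import Data.List as L
open import Data.Vec using (Vec; []; _∷_; map; sum)
open import Data.Product using (_×_)
open import Relation.Nullary.Decidable using (_×-dec_)
open import Relation.Binary.PropositionalEquality using (_≡_)

box : ∀ {n} → Vec ℕ n → List (Vec ℕ n)
box [] = [ [] ]
box (d ∷ ds) = concatMap (λ x → L.map (x ∷_) (box ds)) (upTo (suc d))

-- #( t·R_{k,d} ∩ ℤ^N ): integer x with 0 ≤ x_i ≤ t d_i and Σ x_i = t k.
latticeR : ∀ {N} → (t k : ℕ) → Vec ℕ N → ℕ
latticeR t k d = length (filter (λ x → sum x ≟ t * k) (box (map (t *_) d)))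

-- #( t·R'_{a,b,c} ∩ ℤ^n ): integer x with 0 ≤ x_i ≤ t c_i and t a ≤ Σ x_i ≤ t b.
latticeR' : ∀ {n} → (t a b : ℕ) → Vec ℕ n → ℕ
latticeR' t a b c =
  length (filter (λ x → (t * a ≤? sum x) ×-dec (sum x ≤? t * b)) (box (map (t *_) c)))

{-# OPTIONS --safe #-}
-- Listing the lattice points of the box ∏ [0, d_i] × [0, e] as the points x of ∏ [0, d_i]
-- each followed by its possible last coordinates y ∈ [0, e], the points with
-- Σ x + y = K fall into fibres over x of size one or zero, according to whether
-- K − e ≤ Σ x ≤ K. Applied to the dilated data with K = t b and e = t (b − a), so that
-- K − e = t a, this is the equality of lattice point counts.
module Submission where

open import Defs
open import Data.Bool using (Bool; true; false)
open import Data.Nat using (ℕ; _≤_; _<_; _∸_; zero; suc; s≤s; _+_; _*_; _≤?_; _<?_)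
open import Data.Nat.Properties
  using (_≟_; +-identityʳ; +-assoc; +-suc; *-distribˡ-+; m+[n∸m]≡n; <⇒≤; <⇒≱; <-irrefl;
         <-≤-trans; n≤1+n; n<1+n; m≤m+n; m<1+n⇒m≤n; m≤n⇒m<n∨m≡n;
         +-monoʳ-≤; +-monoˡ-≤; +-monoʳ-<; +-cancelʳ-≤)
open import Data.List using (List; []; _∷_; _++_; [_]; concatMap; length; filter; upTo)
import Data.List as List
open import Data.List.Properties
  using (length-++; filter-++; filter-≐; map-∘; ++-identityʳ; upTo-∷ʳ;
         concatMap-cong; concatMap-map; map-concatMap; concatMap-++; concatMap-pure)
open import Data.Vec using (Vec; []; _∷_; _∷ʳ_; sum)
import Data.Vec as Vec
open import Data.Vec.Properties using (map-∷ʳ)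
open import Data.Vec.Relation.Unary.All using (All)
open import Data.Product using (_×_; _,_)
open import Data.Sum using (_⊎_; inj₁; inj₂)
open import Function using (_∘_)
open import Function.Bundles using (_⇔_; mk⇔)
open import Level using (Level)
open import Relation.Nullary using (Dec; yes; no; ¬_; does; contradiction)
open import Relation.Nullary.Decidable using (_×-dec_; _⊎-dec_; does-⇔; dec-false)
open import Relation.Unary using (Pred; Decidable; _≐_)
open import Relation.Binary.PropositionalEquality
  using (_≡_; refl; sym; trans; cong; cong₂; subst; module ≡-Reasoning)

private variable
  a p q r : Level
  A B : Set a

indicator : Bool → ℕ
indicator false = 0
indicator true  = 1

indicator-⇔ : {P : Set p} {Q : Set q} → P ⇔ Q → (P? : Dec P) (Q? : Dec Q) →
  indicator (does P?) ≡ indicator (does Q?)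
indicator-⇔ P⇔Q P? Q? = cong indicator (does-⇔ P⇔Q P? Q?)

indicator-⊎ : {P : Set p} {Q : Set q} {R : Set r} → ¬ (P × Q) → (P ⊎ Q) ⇔ R →
  (P? : Dec P) (Q? : Dec Q) (R? : Dec R) →
  indicator (does P?) + indicator (does Q?) ≡ indicator (does R?)
indicator-⊎ disjoint P⊎Q⇔R P? Q? R? =
  trans (indicator-⊎-dec P? Q?) (indicator-⇔ P⊎Q⇔R (P? ⊎-dec Q?) R?)
  where
  indicator-⊎-dec : (P? : Dec _) (Q? : Dec _) →
    indicator (does P?) + indicator (does Q?) ≡ indicator (does (P? ⊎-dec Q?))
  indicator-⊎-dec (yes p) (yes q) = contradiction (p , q) disjoint
  indicator-⊎-dec (yes _) (no _)  = refl
  indicator-⊎-dec (no _)  (yes _) = refl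
  indicator-⊎-dec (no _)  (no _)  = refl

count : {P : Pred A p} → Decidable P → List A → ℕ
count P? xs = length (filter P? xs)

module _ {P : Pred A p} (P? : Decidable P) where

  count-∷ : ∀ x xs → count P? (x ∷ xs) ≡ indicator (does (P? x)) + count P? xs
  count-∷ x xs with does (P? x)
  ... | true  = refl
  ... | false = refl

  count-++ : ∀ xs ys → count P? (xs ++ ys) ≡ count P? xs + count P? ys
  count-++ xs ys = trans (cong length (filter-++ P? xs ys)) (length-++ (filter P? xs))

  count-map : (f : B → A) → ∀ xs → count P? (List.map f xs) ≡ count (P? ∘ f) xs
  count-map f []       = refl
  count-map f (x ∷ xs) with does (P? (f x))
  ... | true  = cong suc (count-map f xs)
  ... | false = count-map f xs

count-≐ : {P : Pred A p} {Q : Pred A q} (P? : Decidable P) (Q? : Decidable Q) →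
  P ≐ Q → ∀ xs → count P? xs ≡ count Q? xs
count-≐ P? Q? P≐Q xs = cong length (filter-≐ P? Q? P≐Q xs)

count-concatMap : {P : Pred B p} {Q : Pred A q} (P? : Decidable P) (Q? : Decidable Q)
  (f : A → List B) → (∀ x → count P? (f x) ≡ indicator (does (Q? x))) →
  ∀ xs → count P? (concatMap f xs) ≡ count Q? xs
count-concatMap P? Q? f fibre []       = refl
count-concatMap P? Q? f fibre (x ∷ xs) = begin
  count P? (f x ++ concatMap f xs)
    ≡⟨ count-++ P? (f x) _ ⟩
  count P? (f x) + count P? (concatMap f xs)
    ≡⟨ cong₂ _+_ (fibre x) (count-concatMap P? Q? f fibre xs) ⟩
  indicator (does (Q? x)) + count Q? xs
    ≡⟨ count-∷ Q? x xs ⟨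
  count Q? (x ∷ xs) ∎
  where open ≡-Reasoning

concatMap-concatMap : {C : Set a} (g : B → List C) (f : A → List B) →
  ∀ xs → concatMap g (concatMap f xs) ≡ concatMap (concatMap g ∘ f) xs
concatMap-concatMap g f []       = refl
concatMap-concatMap g f (x ∷ xs) = trans (concatMap-++ g (f x) _)
  (cong (concatMap g (f x) ++_) (concatMap-concatMap g f xs))

extensions : ∀ {n} → ℕ → Vec ℕ n → List (Vec ℕ (suc n))
extensions e x = List.map (x ∷ʳ_) (upTo (suc e))

box-∷ʳ : ∀ {n} (ds : Vec ℕ n) e → box (ds ∷ʳ e) ≡ concatMap (extensions e) (box ds)
box-∷ʳ [] e = begin
  concatMap ([_] ∘ (_∷ [])) U        ≡⟨ concatMap-map [_] (_∷ []) U ⟨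
  concatMap [_] (List.map (_∷ []) U) ≡⟨ concatMap-pure (List.map (_∷ []) U) ⟩
  List.map (_∷ []) U                 ≡⟨ ++-identityʳ (List.map (_∷ []) U) ⟨
  List.map (_∷ []) U ++ []           ∎
  where
  open ≡-Reasoning
  U = upTo (suc e)
box-∷ʳ (d ∷ ds) e = begin
  concatMap (λ x → List.map (x ∷_) (box (ds ∷ʳ e))) R
    ≡⟨ concatMap-cong (λ x → cong (List.map (x ∷_)) (box-∷ʳ ds e)) R ⟩
  concatMap (λ x → List.map (x ∷_) (concatMap (extensions e) (box ds))) R
    ≡⟨ concatMap-cong (λ x → map-∷-extensions x (box ds)) R ⟩
  concatMap (λ x → concatMap (extensions e) (List.map (x ∷_) (box ds))) R
    ≡⟨ concatMap-concatMap (extensions e) (λ x → List.map (x ∷_) (box ds)) R ⟨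
  concatMap (extensions e) (box (d ∷ ds)) ∎
  where
  open ≡-Reasoning
  R = upTo (suc d)

  map-∷-extensions : ∀ {m} x (xs : List (Vec ℕ m)) →
    List.map (x ∷_) (concatMap (extensions e) xs) ≡ concatMap (extensions e) (List.map (x ∷_) xs)
  map-∷-extensions x xs = begin
    List.map (x ∷_) (concatMap (extensions e) xs)   ≡⟨ map-concatMap (x ∷_) (extensions e) xs ⟩
    concatMap (List.map (x ∷_) ∘ extensions e) xs   ≡⟨ concatMap-cong (λ _ → map-∘ (upTo (suc e))) xs ⟨
    concatMap (extensions e ∘ (x ∷_)) xs            ≡⟨ concatMap-map (extensions e) (x ∷_) xs ⟨
    concatMap (extensions e) (List.map (x ∷_) xs)   ∎

sum-∷ʳ : ∀ {n} (xs : Vec ℕ n) y → sum (xs ∷ʳ y) ≡ sum xs + y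
sum-∷ʳ []       y = +-identityʳ y
sum-∷ʳ (x ∷ xs) y = trans (cong (x +_) (sum-∷ʳ xs y)) (sym (+-assoc x (sum xs) y))

count-+≡-upTo : ∀ s K m →
  count (λ y → s + y ≟ K) (upTo m) ≡ indicator (does ((s ≤? K) ×-dec (K <? s + m)))
count-+≡-upTo s K zero = cong indicator (sym (dec-false ((s ≤? K) ×-dec (K <? s + 0)) empty))
  where
  empty : ¬ (s ≤ K × K < s + 0)
  empty (s≤K , K<s+0) = <⇒≱ (subst (K <_) (+-identityʳ s) K<s+0) s≤K
count-+≡-upTo s K (suc m) = begin
  count P? (upTo (suc m))                        ≡⟨ cong (count P?) (upTo-∷ʳ m) ⟨
  count P? (upTo m ++ [ m ])                     ≡⟨ count-++ P? (upTo m) [ m ] ⟩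
  count P? (upTo m) + count P? [ m ]
    ≡⟨ cong₂ _+_ (count-+≡-upTo s K m) (trans (count-∷ P? m []) (+-identityʳ _)) ⟩
  indicator (does ((s ≤? K) ×-dec (K <? s + m))) + indicator (does (s + m ≟ K))
    ≡⟨ indicator-⊎ disjoint extend
         ((s ≤? K) ×-dec (K <? s + m)) (s + m ≟ K) ((s ≤? K) ×-dec (K <? s + suc m)) ⟩
  indicator (does ((s ≤? K) ×-dec (K <? s + suc m))) ∎
  where
  open ≡-Reasoning
  P? = λ y → s + y ≟ K

  disjoint : ¬ ((s ≤ K × K < s + m) × s + m ≡ K)
  disjoint ((_ , K<s+m) , s+m≡K) = <-irrefl (sym s+m≡K) K<s+m

  extend : ((s ≤ K × K < s + m) ⊎ s + m ≡ K) ⇔ (s ≤ K × K < s + suc m)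
  extend = mk⇔ to from
    where
    to : (s ≤ K × K < s + m) ⊎ s + m ≡ K → s ≤ K × K < s + suc m
    to (inj₁ (s≤K , K<s+m)) = s≤K , <-≤-trans K<s+m (+-monoʳ-≤ s (n≤1+n m))
    to (inj₂ refl)          = m≤m+n s m , +-monoʳ-< s (n<1+n m)

    from : s ≤ K × K < s + suc m → (s ≤ K × K < s + m) ⊎ s + m ≡ K
    from (s≤K , K<s+1+m) with m≤n⇒m<n∨m≡n (m<1+n⇒m≤n (subst (K <_) (+-suc s m) K<s+1+m))
    ... | inj₁ K<s+m = inj₁ (s≤K , K<s+m)
    ... | inj₂ K≡s+m = inj₂ (sym K≡s+m)

window : ∀ {L e s K} → K ≡ L + e → (s ≤ K × K < s + suc e) ⇔ (L ≤ s × s ≤ K)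
window {L} {e} {s} refl = mk⇔
  (λ (s≤K , K<s+1+e) → +-cancelʳ-≤ e L s (m<1+n⇒m≤n (subst (L + e <_) (+-suc s e) K<s+1+e)) , s≤K)
  (λ (L≤s , s≤K) → s≤K , subst (L + e <_) (sym (+-suc s e)) (s≤s (+-monoˡ-≤ e L≤s)))

count-sum≡-box-∷ʳ : ∀ {n} (ds : Vec ℕ n) (e L K : ℕ) → K ≡ L + e →
  count (λ x → sum x ≟ K) (box (ds ∷ʳ e)) ≡
  count (λ x → (L ≤? sum x) ×-dec (sum x ≤? K)) (box ds)
count-sum≡-box-∷ʳ ds e L K K≡L+e = begin
  count (λ x → sum x ≟ K) (box (ds ∷ʳ e))
    ≡⟨ cong (count _) (box-∷ʳ ds e) ⟩
  count (λ x → sum x ≟ K) (concatMap (extensions e) (box ds))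
    ≡⟨ count-concatMap _ _ (extensions e) fibre (box ds) ⟩
  count (λ x → (L ≤? sum x) ×-dec (sum x ≤? K)) (box ds) ∎
  where
  open ≡-Reasoning
  fibre : ∀ x → count (λ z → sum z ≟ K) (extensions e x) ≡
                 indicator (does ((L ≤? sum x) ×-dec (sum x ≤? K)))
  fibre x = begin
    count (λ z → sum z ≟ K) (extensions e x)
      ≡⟨ count-map (λ z → sum z ≟ K) (x ∷ʳ_) (upTo (suc e)) ⟩
    count (λ y → sum (x ∷ʳ y) ≟ K) (upTo (suc e))
      ≡⟨ count-≐ (λ y → sum (x ∷ʳ y) ≟ K) (λ y → sum x + y ≟ K) sum-∷ʳ-≐ (upTo (suc e)) ⟩
    count (λ y → sum x + y ≟ K) (upTo (suc e))
      ≡⟨ count-+≡-upTo (sum x) K (suc e) ⟩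
    indicator (does ((sum x ≤? K) ×-dec (K <? sum x + suc e)))
      ≡⟨ indicator-⇔ (window K≡L+e)
           ((sum x ≤? K) ×-dec (K <? sum x + suc e)) ((L ≤? sum x) ×-dec (sum x ≤? K)) ⟩
    indicator (does ((L ≤? sum x) ×-dec (sum x ≤? K))) ∎
    where
    sum-∷ʳ-≐ : (λ y → sum (x ∷ʳ y) ≡ K) ≐ (λ y → sum x + y ≡ K)
    sum-∷ʳ-≐ = (λ {y} → trans (sym (sum-∷ʳ x y))) , (λ {y} → trans (sum-∷ʳ x y))

proposition2p2 : (n : ℕ) (c : Vec ℕ n) → All (λ ci → 1 ≤ ci) c →
    (a b : ℕ) → a < b →
    (t : ℕ) → 1 ≤ t → latticeR' t a b c ≡ latticeR t b (c ∷ʳ (b ∸ a))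
proposition2p2 _ c _ a b a<b t _ = begin
  latticeR' t a b c
    ≡⟨ count-sum≡-box-∷ʳ (Vec.map (t *_) c) (t * (b ∸ a)) (t * a) (t * b) tb≡ta+t[b∸a] ⟨
  count (λ x → sum x ≟ t * b) (box (Vec.map (t *_) c ∷ʳ t * (b ∸ a)))
    ≡⟨ cong (λ ds → count (λ x → sum x ≟ t * b) (box ds)) (map-∷ʳ (t *_) (b ∸ a) c) ⟨
  latticeR t b (c ∷ʳ (b ∸ a)) ∎
  where
  open ≡-Reasoning
  tb≡ta+t[b∸a] : t * b ≡ t * a + t * (b ∸ a)
  tb≡ta+t[b∸a] = begin
    t * b               ≡⟨ cong (t *_) (m+[n∸m]≡n (<⇒≤ a<b)) ⟨
    t * (a + (b ∸ a))   ≡⟨ *-distribˡ-+ t a (b ∸ a) ⟩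
    t * a + t * (b ∸ a) ∎
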